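{- Let $G$ be a finite chordal graph and $u$ any vertex of $G$. (a) If $x$ is an isolated vertex of $G\setminus N_G[u]$, then $(x,u)$ is a good pair in $G$. (b) Let $T$ be any tree model of $G$. If $(x,y)$ is a $(T/u,\square)$-good pair in $G\setminus N_G[u]$, then $(x,y)$ is a good pair in $G$. (c) Let $(T,R)$ be any rooted tree model of $G$ and $G'$ a connected component of $G$. If $(x,y)$ is a $(T|_{V(G')},R)$-good pair in $G'$, then $(x,y)$ is a $(T,R)$-good pair in $G$. In each of the cases (a), (b), (c), $x$ is a simplicial vertex of $G$.
   Context: A graph is chordal if it has no induced cycle of length more than three. $N_G(u)$, $N_G[u]$ are open and closed neighbourhoods; $G\setminus N_G[u]$ is the induced subgraph on $V(G)\setminus N_G[u]$. A pair $(x,y)$ of distinct vertices is good in $G$ if $N_G(x)\subseteq N_G(y)$. A vertex is simplicial if its neighbourhood induces a clique. A tree model of $G$ is a finite tree $T$ (whose vertices are called nodes) such that each node contains a (possibly empty) subset of $V(G)$, for each $v\in V(G)$ the nodes containing $v$ (called $v$-nodes) form a subtree of $T$, and $vw\in E(G)$ iff some node contains both $v$ and $w$. A rooted tree model $(T,R)$ is a tree model with a marked node $R$. For $W\subseteq V(G)$, $T|_W$ is the tree $T$ in which each node keeps only the labels belonging to $W$; it is a tree model of $G[W]$. For a vertex $u$, $(T/u,\square)$ is the rooted tree model of $G\setminus N_G[u]$ obtained from $T$ by contracting all $u$-nodes to a single node $\square$ with empty label set, and erasing all labels of vertices in $N_G[u]$. Given a rooted tree model $(T,R)$ of a graph $H$,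 a pair $(x,y)$ is $(T,R)$-good in $H$ if it is good in $H$ and the shortest path in $T$ from any $x$-node to $R$ contains some $y$-node. -}

module Defs where

open import Data.Nat using (ℕ; zero; suc; _+_; _≤_; _%_)
open import Data.Fin using (Fin; toℕ; _≟_)
open import Data.Bool using (Bool; true; false; _∨_; T)
open import Data.Product using (Σ; ∃; _×_; _,_; proj₁; proj₂)
open import Data.Sum using (_⊎_; inj₁; inj₂)
open import Data.Unit using (⊤; tt)
open import Data.Empty using (⊥)
open import Relation.Nullary using (¬_; does)
open import Relation.Binary.PropositionalEquality using (_≡_; _≢_)
open import Function.Definitions using (Injective)

record Graph (V : Set) : Set where
  field
    adj    : V → V → Bool
    sym    : ∀ x y → adj x y ≡ adj y x
    irrefl : ∀ x → adj x x ≡ false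

open Graph public

Edge : {V : Set} → Graph V → V → V → Set
Edge G x y = adj G x y ≡ true

Sub : {V : Set} → (V → Bool) → Set
Sub {V} W = Σ V (λ v → W v ≡ true)

induced : {V : Set} → Graph V → (W : V → Bool) → Graph (Sub W)
induced G W = record
  { adj = λ a b → adj G (proj₁ a) (proj₁ b)
  ; sym = λ a b → sym G (proj₁ a) (proj₁ b)
  ; irrefl = λ a → irrefl G (proj₁ a) }

closedNbr : {n : ℕ} → Graph (Fin n) → Fin n → Fin n → Bool
closedNbr G u v = does (u ≟ v) ∨ adj G u v

notClosedNbr : {n : ℕ} → Graph (Fin n) → Fin n → Fin n → Bool
notClosedNbr G u v with closedNbr G u v
... | true = false
... | false = true

deleteClosedNbr : {n : ℕ} → (G : Graph (Fin n)) → (u : Fin n) → Graph (Sub (notClosedNbr G u))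
deleteClosedNbr G u = induced G (notClosedNbr G u)

Good : {V : Set} → Graph V → V → V → Set
Good G x y = x ≢ y × (∀ z → Edge G x z → Edge G y z)

Simplicial : {V : Set} → Graph V → V → Set
Simplicial G x = ∀ a b → Edge G x a → Edge G x b → a ≢ b → Edge G a b

Isolated : {V : Set} → Graph V → V → Set
Isolated G x = ∀ z → ¬ Edge G x z

CycAdj : (k : ℕ) → Fin (4 + k) → Fin (4 + k) → Set
CycAdj k i j = ((suc (toℕ i)) % (4 + k) ≡ toℕ j) ⊎ ((suc (toℕ j)) % (4 + k) ≡ toℕ i)

Chordal : {n : ℕ} → Graph (Fin n) → Set
Chordal {n} G = ∀ (k : ℕ) (c : Fin (4 + k) → Fin n) → Injective _≡_ _≡_ c →
  ¬ (∀ i j → (Edge G (c i) (c j) → CycAdj k i j) × (CycAdj k i j → Edge G (c i) (c j)))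

data Walk {A : Set} (R : A → A → Set) : A → A → Set where
  []  : ∀ {a} → Walk R a a
  _∷_ : ∀ {a b c} → R a b → Walk R b c → Walk R a c

walkLength : {A : Set} {R : A → A → Set} {a b : A} → Walk R a b → ℕ
walkLength []      = 0
walkLength (_ ∷ w) = suc (walkLength w)

AllNodes : {A : Set} {R : A → A → Set} (P : A → Set) {a b : A} → Walk R a b → Set
AllNodes P {a} []      = P a
AllNodes P {a} (_ ∷ w) = P a × AllNodes P w

AnyNode : {A : Set} {R : A → A → Set} (P : A → Set) {a b : A} → Walk R a b → Set
AnyNode P {a} []      = P a
AnyNode P {a} (_ ∷ w) = P a ⊎ AnyNode P w

Shortest : {A : Set} {R : A → A → Set} {a b : A} → Walk R a b → Set
Shortest {R = R} {a} {b} w = ∀ (w' : Walk R a b) → walkLength w ≤ walkLength w'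

next : (k : ℕ) → Fin (3 + k) → Fin (3 + k)
next k i = Data.Fin.fromℕ< {suc (toℕ i) % (3 + k)} (Data.Nat.DivMod.m%n<n (suc (toℕ i)) (3 + k))
  where import Data.Nat.DivMod

record Tree (m : ℕ) : Set where
  field
    graph     : Graph (Fin (suc m))
    connected : ∀ a b → Walk (Edge graph) a b
    acyclic   : ∀ (k : ℕ) (c : Fin (3 + k) → Fin (suc m)) → Injective _≡_ _≡_ c →
                ¬ (∀ i → Edge graph (c i) (c (next k i)))

TEdge : {m : ℕ} → Tree m → Fin (suc m) → Fin (suc m) → Set
TEdge T = Edge (Tree.graph T)

record TreeModel {V : Set} (G : Graph V) : Set where
  field
    m       : ℕ
    tree    : Tree m
    label   : Fin (suc m) → V → Bool      -- label t v ≡ true : node t contains v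
    nonempty : ∀ v → ∃ λ t → label t v ≡ true
    subtree  : ∀ v t s → label t v ≡ true → label s v ≡ true →
               Σ (Walk (TEdge tree) t s) (AllNodes (λ r → label r v ≡ true))
    edges    : ∀ v w → v ≢ w →
               (Edge G v w → ∃ λ t → label t v ≡ true × label t w ≡ true) ×
               ((∃ λ t → label t v ≡ true × label t w ≡ true) → Edge G v w)

record RootedTreeModel {V : Set} (G : Graph V) : Set where
  field
    model : TreeModel G
    root  : Fin (suc (TreeModel.m model))

-- the data of a rooted (labelled) tree, enough to speak about (T,R)-good pairs

record RootedLabelledTree (V : Set) : Set₁ where
  field
    Node  : Set
    TAdj  : Node → Node → Set
    Label : Node → V → Bool
    root  : Node

RGood : {V : Set} → RootedLabelledTree V → Graph V → V → V → Set
RGood S H x y =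
  Good H x y ×
  (∀ t → Label t x ≡ true → (w : Walk TAdj t root) → Shortest w →
     AnyNode (λ s → Label s y ≡ true) w)
  where open RootedLabelledTree S

asRLT : {V : Set} {G : Graph V} → RootedTreeModel G → RootedLabelledTree V
asRLT (record { model = M ; root = R }) = record
  { Node = Fin (suc (TreeModel.m M))
  ; TAdj = TEdge (TreeModel.tree M)
  ; Label = TreeModel.label M
  ; root = R }

restrictRLT : {V : Set} → (W : V → Bool) → RootedLabelledTree V → RootedLabelledTree (Sub W)
restrictRLT W S = record
  { Node = Node ; TAdj = TAdj ; Label = λ t v → Label t (proj₁ v) ; root = root }
  where open RootedLabelledTree S

-- (T/u , □): contract all u-nodes to a single node □ with empty label,
-- erase the labels of N_G[u]
module _ {n : ℕ} {G : Graph (Fin n)} (M : TreeModel G) (u : Fin n) where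
  open TreeModel M

  ContrNode : Set
  ContrNode = Σ (Fin (suc m)) (λ t → label t u ≡ false) ⊎ ⊤

  ContrAdj : ContrNode → ContrNode → Set
  ContrAdj (inj₁ a) (inj₁ b) = TEdge tree (proj₁ a) (proj₁ b)
  ContrAdj (inj₁ a) (inj₂ _) = ∃ λ s → label s u ≡ true × TEdge tree (proj₁ a) s
  ContrAdj (inj₂ _) (inj₁ b) = ∃ λ s → label s u ≡ true × TEdge tree s (proj₁ b)
  ContrAdj (inj₂ _) (inj₂ _) = ⊥

  ContrLabel : ContrNode → Sub (notClosedNbr G u) → Bool
  ContrLabel (inj₁ a) v = label (proj₁ a) (proj₁ v)
  ContrLabel (inj₂ _) v = false

  contract : RootedLabelledTree (Sub (notClosedNbr G u))
  contract = record { Node = ContrNode ; TAdj = ContrAdj ; Label = ContrLabel ; root = inj₂ tt }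

record Component {V : Set} (G : Graph V) (C : V → Bool) : Set where
  field
    inhabited : ∃ λ v → C v ≡ true
    connected : ∀ a b → C a ≡ true → C b ≡ true → Walk (Edge G) a b
    closed    : ∀ a b → C a ≡ true → Edge G a b → C b ≡ true

-- Simpliciality is uniform: in a chordal graph, if N(x) ⊆ N(y) and a, b are
-- non-adjacent neighbours of x, then x a y b is an induced 4-cycle.  So the
-- theorem reduces to three goodness statements.
--   (a), (c) are neighbourhood bookkeeping: a neighbour of a vertex outside
--   N_G[u] is outside N_G[u] or in N_G(u); a component is closed under edges.
--   (b) additionally needs: if x ∉ N_G[u] and z ∈ N(x) ∩ N(u), then y ∼ z.
--   Walk in T inside the z-subtree from an {x,z}-node to a {u,z}-node, stop
--   before the first u-node and erase loops.  In T/u this is a walk to □, and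
--   it is shortest: in a tree every walk between two nodes passes through all
--   nodes of any path between them, so by pigeonhole no walk to □ is shorter.
--   Goodness of (x,y) puts a y-node on it, which is also a z-node, so y ∼ z.

module Submission where

open import Defs
open import Data.Nat using (ℕ; zero; suc; _+_; _≤_; _<_; _%_; z≤n; s≤s; s≤s⁻¹)
  renaming (_≟_ to _ℕ-≟_)
open import Data.Nat.Properties using (m≤n⇒m<n∨m≡n; module ≤-Reasoning)
open import Data.Nat.DivMod using (m<n⇒m%n≡m; n%n≡0; m%n<n)
open import Data.Fin as F using (Fin; toℕ)
open import Data.Fin.Patterns using (0F; 1F; 2F; 3F)
open import Data.Fin.Properties using (toℕ-injective; toℕ-fromℕ<; toℕ≤pred[n])
open import Data.Bool using (Bool; true; false)
open import Data.Bool.Properties using (¬-not)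
import Data.Bool.Properties as Bool
open import Data.Product using (Σ; ∃; _×_; _,_; proj₁; proj₂)
open import Data.Sum using (_⊎_; inj₁; inj₂; [_,_]′)
open import Data.Unit using (⊤; tt)
open import Data.Empty using (⊥; ⊥-elim)
open import Data.List using (List; []; _∷_; length; _++_; [_])
open import Data.List.Properties using (length-removeAt′)
open import Data.List.Relation.Unary.Any using (here; there; index; _─_)
open import Data.List.Membership.Propositional using (_∈_; _∉_)
open import Data.List.Membership.Propositional.Properties using (∈-++⁻; ∈-++⁺ˡ)
open import Data.List.Relation.Binary.Subset.Propositional using (_⊆_)
open import Function using (id; _∘_)
open import Relation.Nullary using (¬_; Dec; yes; no)
open import Relation.Nullary.Decidable using (True; False; toWitness; toWitnessFalse; _⊎-dec_)
open import Relation.Binary.PropositionalEquality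
  using (_≡_; _≢_; refl; cong; subst; subst₂; trans) renaming (sym to ≡-sym)
open import Relation.Binary.Definitions using (DecidableEquality)
open import Axiom.UniquenessOfIdentityProofs using (module Decidable⇒UIP)

true≢false : true ≢ false
true≢false ()

edge-sym : ∀ {V} (G : Graph V) {a b} → Edge G a b → Edge G b a
edge-sym G {a} {b} e = trans (sym G b a) e

edge⇒≢ : ∀ {V} (G : Graph V) {a b} → Edge G a b → a ≢ b
edge⇒≢ G {a} e refl = true≢false (trans (≡-sym e) (irrefl G a))

Sub-≡ : ∀ {V} {W : V → Bool} {a b : Sub W} → proj₁ a ≡ proj₁ b → a ≡ b
Sub-≡ {a = v , p} {b = .v , q} refl = cong (v ,_) (Decidable⇒UIP.≡-irrelevant Bool._≟_ p q)

module _ {n : ℕ} (G : Graph (Fin n)) (u : Fin n) where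

  outside⇒ : ∀ v → notClosedNbr G u v ≡ true → u ≢ v × adj G u v ≡ false
  outside⇒ v out with u F.≟ v | adj G u v
  ... | yes _   | _     = ⊥-elim (true≢false (≡-sym out))
  ... | no u≢v  | false = u≢v , refl
  ... | no _    | true  = ⊥-elim (true≢false (≡-sym out))

  inside⇒ : ∀ v → notClosedNbr G u v ≡ false → u ≡ v ⊎ Edge G u v
  inside⇒ v ins with u F.≟ v | adj G u v
  ... | yes u≡v | _     = inj₁ u≡v
  ... | no _    | true  = inj₂ refl
  ... | no _    | false = ⊥-elim (true≢false ins)

  outside⇒≢u : ∀ x → notClosedNbr G u x ≡ true → x ≢ u
  outside⇒≢u x out x≡u = proj₁ (outside⇒ x out) (≡-sym x≡u)

  outside⇒≁u : ∀ x → notClosedNbr G u x ≡ true → ¬ Edge G x u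
  outside⇒≁u x out xu = true≢false (trans (≡-sym (edge-sym G xu)) (proj₂ (outside⇒ x out)))

  neighbourOfOutside : ∀ x z → notClosedNbr G u x ≡ true → Edge G x z →
                       notClosedNbr G u z ≡ true ⊎ Edge G u z
  neighbourOfOutside x z outX xz with notClosedNbr G u z in outZ
  ... | true  = inj₁ refl
  ... | false with inside⇒ z outZ
  ...   | inj₁ refl = ⊥-elim (outside⇒≁u x outX xz)
  ...   | inj₂ uz   = inj₂ uz

-- Chordal graphs: the first vertex of a good pair is simplicial

noInducedSquare : ∀ {n} (G : Graph (Fin n)) → Chordal G → ∀ {a₀ a₁ a₂ a₃} →
  Edge G a₀ a₁ → Edge G a₁ a₂ → Edge G a₂ a₃ → Edge G a₃ a₀ →
  ¬ Edge G a₀ a₂ → ¬ Edge G a₁ a₃ → a₀ ≢ a₂ → a₁ ≢ a₃ → ⊥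
noInducedSquare G chordal {a₀} {a₁} {a₂} {a₃} e₀₁ e₁₂ e₂₃ e₃₀ ¬e₀₂ ¬e₁₃ a₀≢a₂ a₁≢a₃ =
  chordal 0 c c-injective table
  where
    c : Fin 4 → Fin _
    c 0F = a₀
    c 1F = a₁
    c 2F = a₂
    c 3F = a₃

    ¬loop : ∀ v → ¬ Edge G v v
    ¬loop v e = edge⇒≢ G e refl

    c-injective : ∀ {i j} → c i ≡ c j → i ≡ j
    c-injective {0F} {0F} _ = refl
    c-injective {0F} {1F} p = ⊥-elim (edge⇒≢ G e₀₁ p)
    c-injective {0F} {2F} p = ⊥-elim (a₀≢a₂ p)
    c-injective {0F} {3F} p = ⊥-elim (edge⇒≢ G e₃₀ (≡-sym p))
    c-injective {1F} {0F} p = ⊥-elim (edge⇒≢ G e₀₁ (≡-sym p))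
    c-injective {1F} {1F} _ = refl
    c-injective {1F} {2F} p = ⊥-elim (edge⇒≢ G e₁₂ p)
    c-injective {1F} {3F} p = ⊥-elim (a₁≢a₃ p)
    c-injective {2F} {0F} p = ⊥-elim (a₀≢a₂ (≡-sym p))
    c-injective {2F} {1F} p = ⊥-elim (edge⇒≢ G e₁₂ (≡-sym p))
    c-injective {2F} {2F} _ = refl
    c-injective {2F} {3F} p = ⊥-elim (edge⇒≢ G e₂₃ p)
    c-injective {3F} {0F} p = ⊥-elim (edge⇒≢ G e₃₀ p)
    c-injective {3F} {1F} p = ⊥-elim (a₁≢a₃ (≡-sym p))
    c-injective {3F} {2F} p = ⊥-elim (edge⇒≢ G e₂₃ (≡-sym p))
    c-injective {3F} {3F} _ = refl

    -- Positions on the 4-cycle are adjacent or not, decidably; this lets the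
    -- table below state each entry by the edge (or non-edge) alone.
    cycAdj? : ∀ i j → Dec (CycAdj 0 i j)
    cycAdj? i j = (suc (toℕ i) % 4 ℕ-≟ toℕ j) ⊎-dec (suc (toℕ j) % 4 ℕ-≟ toℕ i)

    Entry : Fin 4 → Fin 4 → Set
    Entry i j = (Edge G (c i) (c j) → CycAdj 0 i j) × (CycAdj 0 i j → Edge G (c i) (c j))

    side : ∀ {i j} {adjacent : True (cycAdj? i j)} → Edge G (c i) (c j) → Entry i j
    side {adjacent = adjacent} e = (λ _ → toWitness adjacent) , (λ _ → e)

    apart : ∀ {i j} {nonadjacent : False (cycAdj? i j)} → ¬ Edge G (c i) (c j) → Entry i j
    apart {nonadjacent = nonadjacent} ¬e =
      (λ e → ⊥-elim (¬e e)) , (λ a → ⊥-elim (toWitnessFalse nonadjacent a))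

    table : ∀ i j → Entry i j
    table 0F 0F = apart (¬loop a₀)
    table 0F 1F = side e₀₁
    table 0F 2F = apart ¬e₀₂
    table 0F 3F = side (edge-sym G e₃₀)
    table 1F 0F = side (edge-sym G e₀₁)
    table 1F 1F = apart (¬loop a₁)
    table 1F 2F = side e₁₂
    table 1F 3F = apart ¬e₁₃
    table 2F 0F = apart (¬e₀₂ ∘ edge-sym G)
    table 2F 1F = side (edge-sym G e₁₂)
    table 2F 2F = apart (¬loop a₂)
    table 2F 3F = side e₂₃
    table 3F 0F = side e₃₀
    table 3F 1F = apart (¬e₁₃ ∘ edge-sym G)
    table 3F 2F = side (edge-sym G e₂₃)
    table 3F 3F = apart (¬loop a₃)

-- If (x,y) is good in a chordal graph then x is simplicial: two non-adjacent
-- neighbours a, b of x would give the induced 4-cycle x a y b.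
good⇒simplicial : ∀ {n} (G : Graph (Fin n)) → Chordal G → ∀ {x y} → Good G x y → Simplicial G x
good⇒simplicial G chordal {x} {y} (x≢y , x⊆y) a b xa xb a≢b with adj G a b in ab
... | true  = refl
... | false = ⊥-elim (noInducedSquare G chordal
                        xa (edge-sym G (x⊆y a xa)) (x⊆y b xb) (edge-sym G xb)
                        (λ xy → edge⇒≢ G (x⊆y y xy) refl)
                        (λ e → true≢false (trans (≡-sym e) ab))
                        x≢y a≢b)

-- (a) An isolated vertex x of G \ N_G[u] has all its neighbours in N_G(u).
isolated⇒good : ∀ {n} (G : Graph (Fin n)) (u : Fin n) (x : Sub (notClosedNbr G u)) →
                Isolated (deleteClosedNbr G u) x → Good G (proj₁ x) u
isolated⇒good G u (x , outX) isolated =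
  outside⇒≢u G u x outX ,
  λ z xz → [ (λ outZ → ⊥-elim (isolated (z , outZ) xz)) , id ]′
             (neighbourOfOutside G u x z outX xz)

-- (c) in the natural generality: a good pair of the subgraph induced by a
-- vertex set closed under adjacency (e.g. a component) is good in G.
closed⇒good : ∀ {V} (G : Graph V) (C : V → Bool) →
              (∀ a b → C a ≡ true → Edge G a b → C b ≡ true) →
              (x y : Sub C) → Good (induced G C) x y → Good G (proj₁ x) (proj₁ y)
closed⇒good G C closed (x , x∈C) y (x≢y , x⊆y) =
  (λ p → x≢y (Sub-≡ p)) , λ z xz → x⊆y (z , closed x z x∈C xz) xz

deletion⇒good : ∀ {n} (G : Graph (Fin n)) (u : Fin n) (x y : Sub (notClosedNbr G u)) →
                Good (deleteClosedNbr G u) x y →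
                (∀ z → Edge G (proj₁ x) z → Edge G u z → Edge G (proj₁ y) z) →
                Good G (proj₁ x) (proj₁ y)
deletion⇒good G u (x , outX) y (x≢y , x⊆y) shared =
  (λ p → x≢y (Sub-≡ p)) ,
  λ z xz → [ (λ outZ → x⊆y (z , outZ) xz) , shared z xz ]′ (neighbourOfOutside G u x z outX xz)

-- Walks and paths along a symmetric relation with decidable equality

module Walks {N : Set} (E : N → N → Set) (E-sym : ∀ {a b} → E a b → E b a)
             (_≟_ : DecidableEquality N) where

  open import Data.List.Membership.DecPropositional _≟_ using (_∈?_)

  nodes : ∀ {a b} → Walk E a b → List N
  nodes {a} []      = a ∷ []
  nodes {a} (_ ∷ w) = a ∷ nodes w

  head∈ : ∀ {a b} (w : Walk E a b) → a ∈ nodes w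
  head∈ []      = here refl
  head∈ (_ ∷ _) = here refl

  last∈ : ∀ {a b} (w : Walk E a b) → b ∈ nodes w
  last∈ []      = here refl
  last∈ (_ ∷ w) = there (last∈ w)

  length-nodes : ∀ {a b} (w : Walk E a b) → length (nodes w) ≡ suc (walkLength w)
  length-nodes []      = refl
  length-nodes (_ ∷ w) = cong suc (length-nodes w)

  AllNodes⇒∈ : ∀ {P : N → Set} {a b} (w : Walk E a b) → AllNodes P w → ∀ {v} → v ∈ nodes w → P v
  AllNodes⇒∈ []      p       (here refl) = p
  AllNodes⇒∈ (_ ∷ w) (p , _) (here refl) = p
  AllNodes⇒∈ (_ ∷ w) (_ , ps) (there v∈w) = AllNodes⇒∈ w ps v∈w

  _++ʷ_ : ∀ {a b c} → Walk E a b → Walk E b c → Walk E a c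
  []      ++ʷ w′ = w′
  (e ∷ w) ++ʷ w′ = e ∷ (w ++ʷ w′)

  ∈-++ʷ⁻ : ∀ {a b c} (w : Walk E a b) (w′ : Walk E b c) {v} →
           v ∈ nodes (w ++ʷ w′) → v ∈ nodes w ⊎ v ∈ nodes w′
  ∈-++ʷ⁻ []      w′ v∈    = inj₂ v∈
  ∈-++ʷ⁻ (e ∷ w) w′ (here p) = inj₁ (here p)
  ∈-++ʷ⁻ (e ∷ w) w′ (there v∈) with ∈-++ʷ⁻ w w′ v∈
  ... | inj₁ v∈w  = inj₁ (there v∈w)
  ... | inj₂ v∈w′ = inj₂ v∈w′

  nodes-∷ʳ : ∀ {a b c} (w : Walk E a b) (e : E b c) → nodes (w ++ʷ (e ∷ [])) ≡ nodes w ++ [ c ]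
  nodes-∷ʳ []       e = refl
  nodes-∷ʳ (e′ ∷ w) e = cong (_ ∷_) (nodes-∷ʳ w e)

  reverse : ∀ {a b} → Walk E a b → Walk E b a
  reverse []      = []
  reverse (e ∷ w) = reverse w ++ʷ (E-sym e ∷ [])

  ∈-reverse : ∀ {a b} (w : Walk E a b) {v} → v ∈ nodes (reverse w) → v ∈ nodes w
  ∈-reverse []      v∈ = v∈
  ∈-reverse (e ∷ w) {v} v∈
    with ∈-++⁻ (nodes (reverse w)) (subst (v ∈_) (nodes-∷ʳ (reverse w) (E-sym e)) v∈)
  ... | inj₁ v∈w       = there (∈-reverse w v∈w)
  ... | inj₂ (here v≡) = here v≡

  -- Lists without repetitions; a walk whose node list is Distinct is a path.
  Distinct : List N → Set
  Distinct []       = ⊤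
  Distinct (x ∷ xs) = x ∉ xs × Distinct xs

  distinct-∷ʳ : ∀ {c} xs → Distinct xs → c ∉ xs → Distinct (xs ++ [ c ])
  distinct-∷ʳ []       _            _  = (λ ()) , tt
  distinct-∷ʳ {c} (x ∷ xs) (x∉xs , d) c∉ = x∉ , distinct-∷ʳ xs d (c∉ ∘ there)
    where
      x∉ : x ∉ xs ++ [ c ]
      x∉ x∈ with ∈-++⁻ xs x∈
      ... | inj₁ x∈xs      = x∉xs x∈xs
      ... | inj₂ (here x≡c) = c∉ (here (≡-sym x≡c))

  dropUntil : ∀ {a c x} (w : Walk E a c) → x ∈ nodes w →
              Σ (Walk E x c) λ s → nodes s ⊆ nodes w × (Distinct (nodes w) → Distinct (nodes s))
  dropUntil []      (here refl) = [] , id , id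
  dropUntil (e ∷ w) (here refl) = (e ∷ w) , id , id
  dropUntil (e ∷ w) (there x∈w) with dropUntil w x∈w
  ... | s , s⊆w , ds = s , (λ v∈s → there (s⊆w v∈s)) , (λ d → ds (proj₂ d))

  toPath : ∀ {a b} (w : Walk E a b) → Σ (Walk E a b) λ p → Distinct (nodes p) × nodes p ⊆ nodes w
  toPath []        = [] , ((λ ()) , tt) , id
  toPath {a} (e ∷ w) with toPath w
  ... | p , dp , p⊆w with a ∈? nodes p
  ...   | yes a∈p = let s , s⊆p , ds = dropUntil p a∈p
                    in s , ds dp , (λ v∈s → there (p⊆w (s⊆p v∈s)))
  ...   | no a∉p  = (e ∷ p) , (a∉p , dp) ,
                    λ { (here refl) → here refl ; (there v∈p) → there (p⊆w v∈p) }

  ∈-─ : ∀ {x v : N} ys (x∈ys : x ∈ ys) → v ∈ ys → v ≢ x → v ∈ (ys ─ x∈ys)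
  ∈-─ (y ∷ ys) (here x≡y)   (here v≡y)   v≢x = ⊥-elim (v≢x (trans v≡y (≡-sym x≡y)))
  ∈-─ (y ∷ ys) (here _)     (there v∈ys) _   = v∈ys
  ∈-─ (y ∷ ys) (there _)    (here v≡y)   _   = here v≡y
  ∈-─ (y ∷ ys) (there x∈ys) (there v∈ys) v≢x = there (∈-─ ys x∈ys v∈ys v≢x)

  distinct-length≤ : ∀ xs ys → Distinct xs → xs ⊆ ys → length xs ≤ length ys
  distinct-length≤ []       ys _            _     = z≤n
  distinct-length≤ (x ∷ xs) ys (x∉xs , d) xs⊆ys =
    subst (suc (length xs) ≤_) (≡-sym (length-removeAt′ ys (index x∈ys)))
          (s≤s (distinct-length≤ xs (ys ─ x∈ys) d rest))
    where
      x∈ys : x ∈ ys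
      x∈ys = xs⊆ys (here refl)
      rest : xs ⊆ (ys ─ x∈ys)
      rest v∈xs = ∈-─ ys x∈ys (xs⊆ys (there v∈xs)) (λ v≡x → x∉xs (subst (_∈ xs) v≡x v∈xs))

  path-length≤ : ∀ {a b c d} (p : Walk E a b) (w : Walk E c d) →
                 Distinct (nodes p) → nodes p ⊆ nodes w → walkLength p ≤ walkLength w
  path-length≤ p w dp p⊆w =
    s≤s⁻¹ (subst₂ _≤_ (length-nodes p) (length-nodes w) (distinct-length≤ _ _ dp p⊆w))

  -- The i-th node of a walk (its last node once i exceeds the length).
  node : ∀ {a b} → Walk E a b → ℕ → N
  node {a} w       zero    = a
  node {a} []      (suc i) = a
  node     (_ ∷ w) (suc i) = node w i

  node-step : ∀ {a b} (w : Walk E a b) {i} → i < walkLength w → E (node w i) (node w (suc i))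
  node-step (e ∷ [])     {zero}  _         = e
  node-step (e ∷ _ ∷ _)  {zero}  _         = e
  node-step (_ ∷ w)      {suc i} (s≤s i<w) = node-step w i<w

  node-last : ∀ {a b} (w : Walk E a b) → node w (walkLength w) ≡ b
  node-last []      = refl
  node-last (_ ∷ w) = node-last w

  node-∈ : ∀ {a b} (w : Walk E a b) {i} → i ≤ walkLength w → node w i ∈ nodes w
  node-∈ []      {zero}  _         = here refl
  node-∈ (_ ∷ w) {zero}  _         = here refl
  node-∈ (_ ∷ w) {suc i} (s≤s i≤w) = there (node-∈ w i≤w)

  node-injective : ∀ {a b} (w : Walk E a b) → Distinct (nodes w) → ∀ {i j} →
                   i ≤ walkLength w → j ≤ walkLength w → node w i ≡ node w j → i ≡ j
  node-injective w       _          {zero}  {zero}  _         _         _ = refl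
  node-injective (_ ∷ w) (a∉w , _)  {zero}  {suc j} _         (s≤s j≤w) p =
    ⊥-elim (a∉w (subst (_∈ nodes w) (≡-sym p) (node-∈ w j≤w)))
  node-injective (_ ∷ w) (a∉w , _)  {suc i} {zero}  (s≤s i≤w) _         p =
    ⊥-elim (a∉w (subst (_∈ nodes w) p (node-∈ w i≤w)))
  node-injective (_ ∷ w) (_ , dw)   {suc i} {suc j} (s≤s i≤w) (s≤s j≤w) p =
    cong suc (node-injective w dw i≤w j≤w p)

-- Paths in trees

module TreePaths {m : ℕ} (T : Tree m) where

  open Walks (TEdge T) (edge-sym (Tree.graph T)) F._≟_ public
  open import Data.List.Membership.DecPropositional (F._≟_ {suc m}) using (_∈?_)

  noCycle : ∀ {a b} (C : Walk (TEdge T) a b) → Distinct (nodes C) → 2 ≤ walkLength C →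
            TEdge T b a → ⊥
  noCycle []           _        ()            _
  noCycle (_ ∷ [])     _        (s≤s ())      _
  noCycle C@(_ ∷ _ ∷ C′) distinct _ closing = Tree.acyclic T k cycle cycle-injective cycle-step
    where
      k = walkLength C′

      cycle : Fin (3 + k) → Fin (suc m)
      cycle i = node C (toℕ i)

      cycle-injective : ∀ {i j} → cycle i ≡ cycle j → i ≡ j
      cycle-injective {i} {j} p =
        toℕ-injective (node-injective C distinct (toℕ≤pred[n] i) (toℕ≤pred[n] j) p)

      -- Consecutive positions modulo 3 + k are joined: by the path, or by the closing edge.
      cyclicStep : ∀ i → i ≤ walkLength C → TEdge T (node C i) (node C (suc i % (3 + k)))
      cyclicStep i i≤C with m≤n⇒m<n∨m≡n i≤C
      ... | inj₁ i<C  = subst (λ j → TEdge T (node C i) (node C j))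
                              (≡-sym (m<n⇒m%n≡m (s≤s i<C))) (node-step C i<C)
      ... | inj₂ refl = subst₂ (TEdge T) (≡-sym (node-last C))
                               (cong (node C) (≡-sym (n%n≡0 (3 + k)))) closing

      cycle-step : ∀ i → TEdge T (cycle i) (cycle (next k i))
      cycle-step i = subst (λ j → TEdge T (cycle i) (node C j))
                           (≡-sym (toℕ-fromℕ< (m%n<n (suc (toℕ i)) (3 + k))))
                           (cyclicStep (toℕ i) (toℕ≤pred[n] i))

  commonNeighbour∈ : ∀ {x c₁ c₂} → TEdge T x c₁ → TEdge T x c₂ → c₁ ≢ c₂ →
                     (w : Walk (TEdge T) c₁ c₂) → x ∈ nodes w
  commonNeighbour∈ {x} e₁ e₂ c₁≢c₂ w with toPath w
  ... | p , dp , p⊆w with x ∈? nodes p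
  ...   | yes x∈p = p⊆w x∈p
  ...   | no x∉p  = ⊥-elim (closesCycle p dp x∉p)
    where
      closesCycle : (p : Walk (TEdge T) _ _) → Distinct (nodes p) → x ∉ nodes p → ⊥
      closesCycle []      _  _   = c₁≢c₂ refl
      closesCycle (e ∷ p) dp x∉p =
        noCycle (e₁ ∷ e ∷ p) (x∉p , dp) (s≤s (s≤s z≤n)) (edge-sym (Tree.graph T) e₂)

  second∈ : ∀ {p₀ p₁ q} (e : TEdge T p₀ p₁) (P : Walk (TEdge T) p₁ q) →
            p₀ ∉ nodes P → Distinct (nodes P) → (w : Walk (TEdge T) p₀ q) → p₁ ∈ nodes w
  second∈ e []       _   _              w = last∈ w
  second∈ e (e′ ∷ P) p₀∉ (p₁∉P , _) w =
    [ (λ p₁∈P → ⊥-elim (p₁∉P p₁∈P)) , ∈-reverse w ]′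
      (∈-++ʷ⁻ P (reverse w) (commonNeighbour∈ e′ (edge-sym (Tree.graph T) e) p₂≢p₀ (P ++ʷ reverse w)))
    where
      p₂≢p₀ : _ ≢ _
      p₂≢p₀ refl = p₀∉ (there (head∈ P))

  path⊆walk : ∀ {p q} (P : Walk (TEdge T) p q) → Distinct (nodes P) →
              (w : Walk (TEdge T) p q) → nodes P ⊆ nodes w
  path⊆walk []      _           w (here refl) = head∈ w
  path⊆walk (e ∷ P) _           w (here refl) = head∈ w
  path⊆walk (e ∷ P) (p∉P , dP) w (there v∈P)
    with path⊆walk P dP (edge-sym (Tree.graph T) e ∷ w) v∈P
  ... | here refl = second∈ e P p∉P dP w
  ... | there v∈w = v∈w

-- The contracted tree T/u: walks to □ and their shortest representatives

module Contraction {n : ℕ} {G : Graph (Fin n)} (M : TreeModel G) (u : Fin n) where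

  open TreeModel M
  open TreePaths tree

  Node : Set
  Node = Fin (suc m)

  InU : Node → Set
  InU t = label t u ≡ true

  Outside : List Node → Set
  Outside ts = ∀ {t} → t ∈ ts → label t u ≡ false

  □ : ContrNode M u
  □ = inj₂ tt

  -- An approach to the u-subtree from a: a walk in T outside the u-nodes
  -- followed by one step onto a u-node.  These are exactly the walks to □ in T/u.
  record Approach (a : Node) : Set where
    constructor approach
    field
      {end entry} : Node
      path        : Walk (TEdge tree) a end
      outside     : Outside (nodes path)
      step        : TEdge tree end entry
      entered     : InU entry

  open Approach

  liftWalk : ∀ {a b s} (A : Walk (TEdge tree) a b) (a∉U : label a u ≡ false) →
             Outside (nodes A) → TEdge tree b s → InU s → Walk (ContrAdj M u) (inj₁ (a , a∉U)) □
  liftWalk []      _ _   e  s∈U = (_ , s∈U , e) ∷ []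
  liftWalk (e ∷ A) _ out e′ s∈U =
    e ∷ liftWalk A (out (there (head∈ A))) (λ t∈A → out (there t∈A)) e′ s∈U

  lift : ∀ {a} (α : Approach a) (a∉U : label a u ≡ false) → Walk (ContrAdj M u) (inj₁ (a , a∉U)) □
  lift α a∉U = liftWalk (path α) a∉U (outside α) (step α) (entered α)

  length-liftWalk : ∀ {a b s} (A : Walk (TEdge tree) a b) (a∉U : label a u ≡ false)
                    (out : Outside (nodes A)) (e : TEdge tree b s) (s∈U : InU s) →
                    walkLength (liftWalk A a∉U out e s∈U) ≡ suc (walkLength A)
  length-liftWalk []      _ _   _  _   = refl
  length-liftWalk (_ ∷ A) _ out e′ s∈U =
    cong suc (length-liftWalk A _ (λ t∈A → out (there t∈A)) e′ s∈U)

  liftWalk-anyNode : ∀ {a b s} (A : Walk (TEdge tree) a b) (a∉U : label a u ≡ false)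
                     (out : Outside (nodes A)) (e : TEdge tree b s) (s∈U : InU s)
                     (y : Sub (notClosedNbr G u)) →
                     AnyNode (λ t → ContrLabel M u t y ≡ true) (liftWalk A a∉U out e s∈U) →
                     ∃ λ r → r ∈ nodes A × label r (proj₁ y) ≡ true
  liftWalk-anyNode []      _ _   _  _   y (inj₁ a∋y) = _ , here refl , a∋y
  liftWalk-anyNode []      _ _   _  _   y (inj₂ ())
  liftWalk-anyNode (_ ∷ A) _ _   _  _   y (inj₁ a∋y) = _ , here refl , a∋y
  liftWalk-anyNode (_ ∷ A) _ out e′ s∈U y (inj₂ any) =
    let r , r∈A , r∋y = liftWalk-anyNode A _ (λ t∈A → out (there t∈A)) e′ s∈U y any
    in r , there r∈A , r∋y

  project : ∀ {a a∉U} (w : Walk (ContrAdj M u) (inj₁ (a , a∉U)) □) →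
            Σ (Approach a) λ β → suc (walkLength (path β)) ≤ walkLength w
  project {a∉U = a∉U} (_∷_ {b = inj₂ tt} (_ , s∈U , e) _) =
    approach [] (λ { (here refl) → a∉U ; (there ()) }) e s∈U , s≤s z≤n
  project {a∉U = a∉U} (_∷_ {b = inj₁ _} e w) =
    let approach B out e′ s∈U , B<w = project w
    in approach (e ∷ B) (λ { (here refl) → a∉U ; (there t∈B) → out t∈B }) e′ s∈U , s≤s B<w

  firstEntry : ∀ {a b} (w : Walk (TEdge tree) a b) → label a u ≡ false → InU b →
               Σ (Approach a) λ α → nodes (path α) ⊆ nodes w
  firstEntry []                  a∉U a∈U = ⊥-elim (true≢false (trans (≡-sym a∈U) a∉U))
  firstEntry (_∷_ {b = a₁} e w) a∉U b∈U with label a₁ u in a₁∈U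
  ... | true  = approach [] (λ { (here refl) → a∉U ; (there ()) }) e a₁∈U ,
                λ { (here refl) → here refl ; (there ()) }
  ... | false = let approach A out e′ s∈U , A⊆w = firstEntry w a₁∈U b∈U
                in approach (e ∷ A) (λ { (here refl) → a∉U ; (there t∈A) → out t∈A }) e′ s∈U ,
                   λ { (here refl) → here refl ; (there t∈A) → there (A⊆w t∈A) }

  toPathApproach : ∀ {a} (α : Approach a) →
                   Σ (Approach a) λ α′ → Distinct (nodes (path α′)) × nodes (path α′) ⊆ nodes (path α)
  toPathApproach (approach A out e s∈U) =
    let P , dP , P⊆A = toPath A
    in approach P (λ t∈P → out (P⊆A t∈P)) e s∈U , dP , P⊆A

  -- Extend α by its step (still a path, the entry being a u-node) and compare
  -- it with β followed by a walk inside the u-subtree to α's entry.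
  approach⊆ : ∀ {a} (α β : Approach a) → Distinct (nodes (path α)) → nodes (path α) ⊆ nodes (path β)
  approach⊆ (approach A outA e s∈U) (approach B _ e′ s′∈U) dA {v} v∈A =
    onB (∈-++ʷ⁻ B (e′ ∷ proj₁ inU) (path⊆walk (A ++ʷ (e ∷ [])) dA′ (B ++ʷ (e′ ∷ proj₁ inU)) v∈A′))
    where
      inU = subtree u _ _ s′∈U s∈U
      dA′ = subst Distinct (≡-sym (nodes-∷ʳ A e))
                  (distinct-∷ʳ _ dA (λ s∈A → true≢false (trans (≡-sym s∈U) (outA s∈A))))
      v∈A′ = subst (v ∈_) (≡-sym (nodes-∷ʳ A e)) (∈-++⁺ˡ v∈A)
      -- v lies outside the u-subtree, so it is not on the final walk inside it
      onB : v ∈ nodes B ⊎ v ∈ nodes (e′ ∷ proj₁ inU) → v ∈ nodes B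
      onB (inj₁ v∈B)         = v∈B
      onB (inj₂ (here refl)) = last∈ B
      onB (inj₂ (there v∈U)) =
        ⊥-elim (true≢false (trans (≡-sym (AllNodes⇒∈ (proj₁ inU) (proj₂ inU) v∈U)) (outA v∈A)))

  lift-shortest : ∀ {a} (α : Approach a) (a∉U : label a u ≡ false) →
                  Distinct (nodes (path α)) → Shortest (lift α a∉U)
  lift-shortest α a∉U dα w =
    let β , β<w = project w
    in begin
      walkLength (lift α a∉U)   ≡⟨ length-liftWalk (path α) a∉U (outside α) (step α) (entered α) ⟩
      suc (walkLength (path α)) ≤⟨ s≤s (path-length≤ (path α) (path β) dα (approach⊆ α β dα)) ⟩
      suc (walkLength (path β)) ≤⟨ β<w ⟩
      walkLength w              ∎
    where open ≤-Reasoning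

  sharedNeighbour : (x y : Sub (notClosedNbr G u)) →
    (∀ t → ContrLabel M u t x ≡ true → (w : Walk (ContrAdj M u) t □) → Shortest w →
       AnyNode (λ s → ContrLabel M u s y ≡ true) w) →
    ∀ z → Edge G (proj₁ x) z → Edge G u z → Edge G (proj₁ y) z
  sharedNeighbour (x , outX) (y , outY) viaRoot z xz uz =
    let t₀ , t₀∋x , t₀∋z = proj₁ (edges x z (edge⇒≢ G xz)) xz
        r₀ , r₀∋u , r₀∋z = proj₁ (edges u z (edge⇒≢ G uz)) uz
        -- t₀ is not a u-node, since x ≁ u
        t₀∉U : label t₀ u ≡ false
        t₀∉U = ¬-not λ t₀∈U →
          outside⇒≁u G u x outX (proj₂ (edges x u (outside⇒≢u G u x outX)) (t₀ , t₀∋x , t₀∈U))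
        Z , Z∋z = subtree z t₀ r₀ t₀∋z r₀∋z
        α , α⊆Z = firstEntry Z t₀∉U r₀∋u
        α′ , dα′ , α′⊆α = toPathApproach α
        r , r∈α′ , r∋y = liftWalk-anyNode (path α′) t₀∉U (outside α′) (step α′) (entered α′) (y , outY)
                           (viaRoot (inj₁ (t₀ , t₀∉U)) t₀∋x (lift α′ t₀∉U) (lift-shortest α′ t₀∉U dα′))
        y≢z : y ≢ z
        y≢z y≡z = outside⇒≁u G u y outY (edge-sym G (subst (Edge G u) (≡-sym y≡z) uz))
    in proj₂ (edges y z y≢z) (r , r∋y , AllNodes⇒∈ Z Z∋z (α⊆Z (α′⊆α r∈α′)))

lemma3p2 : ∀ {n : ℕ} (G : Graph (Fin n)) → Chordal G → (u : Fin n) →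
    -- (a)
    (∀ (x : Sub (notClosedNbr G u)) → Isolated (deleteClosedNbr G u) x →
       Good G (proj₁ x) u × Simplicial G (proj₁ x)) ×
    -- (b)
    (∀ (M : TreeModel G) (x y : Sub (notClosedNbr G u)) →
       RGood (contract M u) (deleteClosedNbr G u) x y →
       Good G (proj₁ x) (proj₁ y) × Simplicial G (proj₁ x)) ×
    -- (c)
    (∀ (RM : RootedTreeModel G) (C : Fin n → Bool) → Component G C →
       ∀ (x y : Sub C) →
       RGood (restrictRLT C (asRLT RM)) (induced G C) x y →
       RGood (asRLT RM) G (proj₁ x) (proj₁ y) × Simplicial G (proj₁ x))
lemma3p2 G chordal u =
    (λ x isolated → withSimplicial (isolated⇒good G u x isolated))
  , (λ M x y (goodH , viaRoot) →
       withSimplicial (deletion⇒good G u x y goodH (Contraction.sharedNeighbour M u x y viaRoot)))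
  , (λ RM C component x y (goodC , viaRoot) →
       let good = closed⇒good G C (Component.closed component) x y goodC
       in (good , viaRoot) , good⇒simplicial G chordal good)
  where
    withSimplicial : ∀ {x y} → Good G x y → Good G x y × Simplicial G x
    withSimplicial good = good , good⇒simplicial G chordal good
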